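{- Let $\mathbf{D}$ be a D-core algebra and $x,y,z\in D$. Then: (1a) $((x\sqcap y)\sqcap z)\sqcap\neg x=\bot$, (1b) $((x\sqcup y)\sqcup z)\sqcup\lrcorner x=\top$; (2a) $\neg(x\sqcap y)\sqcap\neg(x\sqcap\neg y)=\neg x$, (2b) $\lrcorner(x\sqcup y)\sqcup\lrcorner(\lrcorner y\sqcup x)=\lrcorner x$; (3a) $\neg(\neg(x\sqcap(y\sqcap z))\sqcap z)\sqcap z=x\sqcap(y\sqcap z)$, (3b) $\lrcorner(\lrcorner(x\sqcup(y\sqcup z))\sqcup z)\sqcup z=x\sqcup(y\sqcup z)$.
   Context: Write $x\vee y:=\neg(\neg x\sqcap\neg y)$ and $x\wedge y:=\lrcorner(\lrcorner x\sqcup\lrcorner y)$. A D-core algebra is an algebra $(D;\sqcap,\sqcup,\neg,\lrcorner,\top,\bot)$ of type $(2,2,1,1,0,0)$ satisfying, for all $x,y,z\in D$: $x\sqcap y=y\sqcap x$; $x\sqcup y=y\sqcup x$; $\neg(x\sqcap x)=\neg x$; $\lrcorner(x\sqcup x)=\lrcorner x$; $x\sqcap(x\sqcup y)=x\sqcap x$; $x\sqcup(x\sqcap y)=x\sqcup x$; $x\sqcap(y\vee z)=(x\sqcap y)\vee(x\sqcap z)$; $x\sqcup(y\wedge z)=(x\sqcup y)\wedge(x\sqcup z)$; $\neg\neg(x\sqcap y)=x\sqcap y$; $\lrcorner\lrcorner(x\sqcup y)=x\sqcup y$; $x\sqcap\neg x=\bot$; $x\sqcup\lrcorner x=\top$;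 $(x\sqcap x)\sqcup(x\sqcap x)=(x\sqcup x)\sqcap(x\sqcup x)$. -}

module Defs where

open import Level using (Level; suc)
open import Relation.Binary.PropositionalEquality using (_≡_)

record DCoreAlgebra (a : Level) : Set (suc a) where
  infixr 6 _⊓_ _⊔_ _∨_ _∧_
  field
    Carrier : Set a
    _⊓_ _⊔_ : Carrier → Carrier → Carrier
    ¬_ ⌟_   : Carrier → Carrier
    ⊤ ⊥     : Carrier

  _∨_ : Carrier → Carrier → Carrier
  x ∨ y = ¬ ((¬ x) ⊓ (¬ y))

  _∧_ : Carrier → Carrier → Carrier
  x ∧ y = ⌟ ((⌟ x) ⊔ (⌟ y))

  field
    ⊓-comm     : ∀ x y → x ⊓ y ≡ y ⊓ x
    ⊔-comm     : ∀ x y → x ⊔ y ≡ y ⊔ x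
    ¬-idem     : ∀ x → ¬ (x ⊓ x) ≡ ¬ x
    ⌟-idem     : ∀ x → ⌟ (x ⊔ x) ≡ ⌟ x
    ⊓-absorb   : ∀ x y → x ⊓ (x ⊔ y) ≡ x ⊓ x
    ⊔-absorb   : ∀ x y → x ⊔ (x ⊓ y) ≡ x ⊔ x
    ⊓-distrib-∨ : ∀ x y z → x ⊓ (y ∨ z) ≡ (x ⊓ y) ∨ (x ⊓ z)
    ⊔-distrib-∧ : ∀ x y z → x ⊔ (y ∧ z) ≡ (x ⊔ y) ∧ (x ⊔ z)
    ¬¬-⊓       : ∀ x y → ¬ (¬ (x ⊓ y)) ≡ x ⊓ y
    ⌟⌟-⊔       : ∀ x y → ⌟ (⌟ (x ⊔ y)) ≡ x ⊔ y
    ⊓-¬        : ∀ x → x ⊓ (¬ x) ≡ ⊥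
    ⊔-⌟        : ∀ x → x ⊔ (⌟ x) ≡ ⊤
    ⊓⊔-mix     : ∀ x → (x ⊓ x) ⊔ (x ⊓ x) ≡ (x ⊔ x) ⊓ (x ⊔ x)

-- The elements fixed by ¬¬ are exactly the squares x ⊓ x, and on them ⊓, ∨ and ¬ obey the
-- Boolean laws. The crux is associativity of ⊓, proved by Huntington's argument: ¬¬u is
-- recovered as (x ∨ u) ⊓ (¬ x ∨ u), and for u = (x ⊓ y) ⊓ z and u = x ⊓ (y ⊓ z) both factors
-- coincide. The ⊔-identities are the ⊓-identities of the dual algebra, obtained by swapping
-- ⊓/⊔, ¬/⌟ and ⊥/⊤.
{-# OPTIONS --safe #-}
module Submission where

open import Defs
open import Level using (Level)
open import Data.Product using (_×_; _,_)
open import Relation.Binary.PropositionalEquality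
  using (_≡_; sym; trans; cong; cong₂; module ≡-Reasoning)
open ≡-Reasoning

dual : {a : Level} → DCoreAlgebra a → DCoreAlgebra a
dual D = record
  { Carrier = Carrier ; _⊓_ = _⊔_ ; _⊔_ = _⊓_ ; ¬_ = ⌟_ ; ⌟_ = ¬_ ; ⊤ = ⊥ ; ⊥ = ⊤
  ; ⊓-comm = ⊔-comm ; ⊔-comm = ⊓-comm ; ¬-idem = ⌟-idem ; ⌟-idem = ¬-idem
  ; ⊓-absorb = ⊔-absorb ; ⊔-absorb = ⊓-absorb
  ; ⊓-distrib-∨ = ⊔-distrib-∧ ; ⊔-distrib-∧ = ⊓-distrib-∨
  ; ¬¬-⊓ = ⌟⌟-⊔ ; ⌟⌟-⊔ = ¬¬-⊓ ; ⊓-¬ = ⊔-⌟ ; ⊔-⌟ = ⊓-¬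
  ; ⊓⊔-mix = λ x → sym (⊓⊔-mix x)
  }
  where open DCoreAlgebra D

module Properties {a : Level} (D : DCoreAlgebra a) where
  open DCoreAlgebra D

  x⊓x≡¬¬x : ∀ x → x ⊓ x ≡ ¬ ¬ x
  x⊓x≡¬¬x x = trans (sym (¬¬-⊓ x x)) (cong ¬_ (¬-idem x))

  ¬¬¬x≡¬x : ∀ x → ¬ ¬ ¬ x ≡ ¬ x
  ¬¬¬x≡¬x x = begin
    ¬ ¬ ¬ x        ≡⟨ cong ¬_ (x⊓x≡¬¬x x) ⟨
    ¬ (x ⊓ x)      ≡⟨ ¬-idem x ⟩
    ¬ x            ∎

  ⊓-¬¬ʳ : ∀ x y → x ⊓ ¬ ¬ y ≡ x ⊓ y
  ⊓-¬¬ʳ x y = begin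
    x ⊓ ¬ ¬ y          ≡⟨ cong (x ⊓_) (¬-idem (¬ y)) ⟨
    x ⊓ (y ∨ y)        ≡⟨ ⊓-distrib-∨ x y y ⟩
    (x ⊓ y) ∨ (x ⊓ y)  ≡⟨ ¬-idem (¬ (x ⊓ y)) ⟩
    ¬ ¬ (x ⊓ y)        ≡⟨ ¬¬-⊓ x y ⟩
    x ⊓ y              ∎

  ⊓-¬¬ˡ : ∀ x y → ¬ ¬ x ⊓ y ≡ x ⊓ y
  ⊓-¬¬ˡ x y = trans (⊓-comm (¬ ¬ x) y) (trans (⊓-¬¬ʳ y x) (⊓-comm y x))

  ∨-comm : ∀ x y → x ∨ y ≡ y ∨ x
  ∨-comm x y = cong ¬_ (⊓-comm (¬ x) (¬ y))

  ∨-¬¬ˡ : ∀ x y → ¬ ¬ x ∨ y ≡ x ∨ y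
  ∨-¬¬ˡ x y = cong (λ t → ¬ (t ⊓ ¬ y)) (¬¬¬x≡¬x x)

  ⊓-⊤ʳ : ∀ x → x ⊓ ⊤ ≡ ¬ ¬ x
  ⊓-⊤ʳ x = begin
    x ⊓ ⊤          ≡⟨ cong (x ⊓_) (⊔-⌟ x) ⟨
    x ⊓ (x ⊔ ⌟ x)  ≡⟨ ⊓-absorb x (⌟ x) ⟩
    x ⊓ x          ≡⟨ x⊓x≡¬¬x x ⟩
    ¬ ¬ x          ∎

  ⊥≡¬⊤ : ⊥ ≡ ¬ ⊤
  ⊥≡¬⊤ = begin
    ⊥          ≡⟨ ⊓-¬ ⊤ ⟨
    ⊤ ⊓ ¬ ⊤    ≡⟨ ⊓-comm ⊤ (¬ ⊤) ⟩
    ¬ ⊤ ⊓ ⊤    ≡⟨ ⊓-⊤ʳ (¬ ⊤) ⟩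
    ¬ ¬ ¬ ⊤    ≡⟨ ¬¬¬x≡¬x ⊤ ⟩
    ¬ ⊤        ∎

  ⊓-¬⊥ʳ : ∀ x → x ⊓ ¬ ⊥ ≡ ¬ ¬ x
  ⊓-¬⊥ʳ x = begin
    x ⊓ ¬ ⊥      ≡⟨ cong (λ t → x ⊓ ¬ t) ⊥≡¬⊤ ⟩
    x ⊓ ¬ ¬ ⊤    ≡⟨ ⊓-¬¬ʳ x ⊤ ⟩
    x ⊓ ⊤        ≡⟨ ⊓-⊤ʳ x ⟩
    ¬ ¬ x        ∎

  ⊓-¬⊥ˡ : ∀ x → ¬ ⊥ ⊓ x ≡ ¬ ¬ x
  ⊓-¬⊥ˡ x = trans (⊓-comm (¬ ⊥) x) (⊓-¬⊥ʳ x)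

  ∨-⊥ʳ : ∀ x → x ∨ ⊥ ≡ ¬ ¬ x
  ∨-⊥ʳ x = cong ¬_ (trans (⊓-¬⊥ʳ (¬ x)) (¬¬¬x≡¬x x))

  ∨-¬ʳ : ∀ x → x ∨ ¬ x ≡ ¬ ⊥
  ∨-¬ʳ x = cong ¬_ (⊓-¬ (¬ x))

  ∨-¬ˡ : ∀ x → ¬ x ∨ x ≡ ¬ ⊥
  ∨-¬ˡ x = trans (∨-comm (¬ x) x) (∨-¬ʳ x)

  ∨-distribˡ-⊓ : ∀ x y z → x ∨ (y ⊓ z) ≡ (x ∨ y) ⊓ (x ∨ z)
  ∨-distribˡ-⊓ x y z = begin
    ¬ (¬ x ⊓ ¬ (y ⊓ z))        ≡⟨ cong (λ t → ¬ (¬ x ⊓ ¬ t)) ¬¬y⊓¬¬z≡y⊓z ⟨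
    ¬ (¬ x ⊓ (¬ y ∨ ¬ z))      ≡⟨ cong ¬_ (⊓-distrib-∨ (¬ x) (¬ y) (¬ z)) ⟩
    ¬ ¬ ((x ∨ y) ⊓ (x ∨ z))    ≡⟨ ¬¬-⊓ (x ∨ y) (x ∨ z) ⟩
    (x ∨ y) ⊓ (x ∨ z)          ∎
    where
    ¬¬y⊓¬¬z≡y⊓z : ¬ ¬ y ⊓ ¬ ¬ z ≡ y ⊓ z
    ¬¬y⊓¬¬z≡y⊓z = trans (⊓-¬¬ˡ y (¬ ¬ z)) (⊓-¬¬ʳ y z)

  ⊓-zeroʳ : ∀ x → x ⊓ ⊥ ≡ ⊥
  ⊓-zeroʳ x = begin
    x ⊓ ⊥                  ≡⟨ ¬¬-⊓ x ⊥ ⟨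
    ¬ ¬ (x ⊓ ⊥)            ≡⟨ ∨-⊥ʳ (x ⊓ ⊥) ⟨
    (x ⊓ ⊥) ∨ ⊥            ≡⟨ cong ((x ⊓ ⊥) ∨_) (⊓-¬ x) ⟨
    (x ⊓ ⊥) ∨ (x ⊓ ¬ x)    ≡⟨ ⊓-distrib-∨ x ⊥ (¬ x) ⟨
    x ⊓ (⊥ ∨ ¬ x)          ≡⟨ cong (x ⊓_) (∨-comm ⊥ (¬ x)) ⟩
    x ⊓ (¬ x ∨ ⊥)          ≡⟨ cong (x ⊓_) (trans (∨-⊥ʳ (¬ x)) (¬¬¬x≡¬x x)) ⟩
    x ⊓ ¬ x                ≡⟨ ⊓-¬ x ⟩
    ⊥                      ∎

  ⊓-zeroˡ : ∀ x → ⊥ ⊓ x ≡ ⊥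
  ⊓-zeroˡ x = trans (⊓-comm ⊥ x) (⊓-zeroʳ x)

  ∨-zeroʳ : ∀ x → x ∨ ¬ ⊥ ≡ ¬ ⊥
  ∨-zeroʳ x = cong ¬_ (trans (⊓-¬¬ʳ (¬ x) ⊥) (⊓-zeroʳ (¬ x)))

  ∨-absorbs-⊓ : ∀ x y → x ∨ (x ⊓ y) ≡ ¬ ¬ x
  ∨-absorbs-⊓ x y = begin
    x ∨ (x ⊓ y)              ≡⟨ ∨-¬¬ˡ x (x ⊓ y) ⟨
    ¬ ¬ x ∨ (x ⊓ y)          ≡⟨ cong (_∨ (x ⊓ y)) (⊓-¬⊥ʳ x) ⟨
    (x ⊓ ¬ ⊥) ∨ (x ⊓ y)      ≡⟨ ⊓-distrib-∨ x (¬ ⊥) y ⟨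
    x ⊓ (¬ ⊥ ∨ y)            ≡⟨ cong (x ⊓_) (trans (∨-comm (¬ ⊥) y) (∨-zeroʳ y)) ⟩
    x ⊓ ¬ ⊥                  ≡⟨ ⊓-¬⊥ʳ x ⟩
    ¬ ¬ x                    ∎

  ⊓-absorbs-∨ : ∀ x y → x ⊓ (x ∨ y) ≡ ¬ ¬ x
  ⊓-absorbs-∨ x y = begin
    x ⊓ (x ∨ y)              ≡⟨ ⊓-¬¬ˡ x (x ∨ y) ⟨
    ¬ ¬ x ⊓ (x ∨ y)          ≡⟨ cong (_⊓ (x ∨ y)) (∨-⊥ʳ x) ⟨
    (x ∨ ⊥) ⊓ (x ∨ y)        ≡⟨ ∨-distribˡ-⊓ x ⊥ y ⟨
    x ∨ (⊥ ⊓ y)              ≡⟨ cong (x ∨_) (⊓-zeroˡ y) ⟩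
    x ∨ ⊥                    ≡⟨ ∨-⊥ʳ x ⟩
    ¬ ¬ x                    ∎

  ¬-∨-⊓ : ∀ x y → ¬ x ∨ (x ⊓ y) ≡ ¬ x ∨ y
  ¬-∨-⊓ x y = begin
    ¬ x ∨ (x ⊓ y)                ≡⟨ ∨-distribˡ-⊓ (¬ x) x y ⟩
    (¬ x ∨ x) ⊓ (¬ x ∨ y)        ≡⟨ cong (_⊓ (¬ x ∨ y)) (∨-¬ˡ x) ⟩
    ¬ ⊥ ⊓ (¬ x ∨ y)              ≡⟨ ⊓-¬⊥ˡ (¬ x ∨ y) ⟩
    ¬ ¬ (¬ x ∨ y)                ≡⟨ ¬¬¬x≡¬x (¬ ¬ x ⊓ ¬ y) ⟩
    ¬ x ∨ y                      ∎

  ¬¬-split : ∀ x u → ¬ ¬ u ≡ (x ∨ u) ⊓ (¬ x ∨ u)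
  ¬¬-split x u = begin
    ¬ ¬ u                    ≡⟨ ∨-⊥ʳ u ⟨
    u ∨ ⊥                    ≡⟨ cong (u ∨_) (⊓-¬ x) ⟨
    u ∨ (x ⊓ ¬ x)            ≡⟨ ∨-distribˡ-⊓ u x (¬ x) ⟩
    (u ∨ x) ⊓ (u ∨ ¬ x)      ≡⟨ cong₂ _⊓_ (∨-comm u x) (∨-comm u (¬ x)) ⟩
    (x ∨ u) ⊓ (¬ x ∨ u)      ∎

  ⊓-assoc : ∀ x y z → (x ⊓ y) ⊓ z ≡ x ⊓ (y ⊓ z)
  ⊓-assoc x y z = begin
    (x ⊓ y) ⊓ z                                    ≡⟨ ¬¬-⊓ (x ⊓ y) z ⟨
    ¬ ¬ ((x ⊓ y) ⊓ z)                              ≡⟨ ¬¬-split x ((x ⊓ y) ⊓ z) ⟩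
    (x ∨ ((x ⊓ y) ⊓ z)) ⊓ (¬ x ∨ ((x ⊓ y) ⊓ z))    ≡⟨ cong₂ _⊓_ x-factor ¬x-factor ⟩
    (x ∨ (x ⊓ (y ⊓ z))) ⊓ (¬ x ∨ (x ⊓ (y ⊓ z)))    ≡⟨ ¬¬-split x (x ⊓ (y ⊓ z)) ⟨
    ¬ ¬ (x ⊓ (y ⊓ z))                              ≡⟨ ¬¬-⊓ x (y ⊓ z) ⟩
    x ⊓ (y ⊓ z)                                    ∎
    where
    x-factor : x ∨ ((x ⊓ y) ⊓ z) ≡ x ∨ (x ⊓ (y ⊓ z))
    x-factor = begin
      x ∨ ((x ⊓ y) ⊓ z)              ≡⟨ ∨-distribˡ-⊓ x (x ⊓ y) z ⟩
      (x ∨ (x ⊓ y)) ⊓ (x ∨ z)        ≡⟨ cong (_⊓ (x ∨ z)) (∨-absorbs-⊓ x y) ⟩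
      ¬ ¬ x ⊓ (x ∨ z)                ≡⟨ ⊓-¬¬ˡ x (x ∨ z) ⟩
      x ⊓ (x ∨ z)                    ≡⟨ ⊓-absorbs-∨ x z ⟩
      ¬ ¬ x                          ≡⟨ ∨-absorbs-⊓ x (y ⊓ z) ⟨
      x ∨ (x ⊓ (y ⊓ z))              ∎
    ¬x-factor : ¬ x ∨ ((x ⊓ y) ⊓ z) ≡ ¬ x ∨ (x ⊓ (y ⊓ z))
    ¬x-factor = begin
      ¬ x ∨ ((x ⊓ y) ⊓ z)            ≡⟨ ∨-distribˡ-⊓ (¬ x) (x ⊓ y) z ⟩
      (¬ x ∨ (x ⊓ y)) ⊓ (¬ x ∨ z)    ≡⟨ cong (_⊓ (¬ x ∨ z)) (¬-∨-⊓ x y) ⟩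
      (¬ x ∨ y) ⊓ (¬ x ∨ z)          ≡⟨ ∨-distribˡ-⊓ (¬ x) y z ⟨
      ¬ x ∨ (y ⊓ z)                  ≡⟨ ¬-∨-⊓ x (y ⊓ z) ⟨
      ¬ x ∨ (x ⊓ (y ⊓ z))            ∎

  x⊓y⊓¬x≡⊥ : ∀ x y → (x ⊓ y) ⊓ ¬ x ≡ ⊥
  x⊓y⊓¬x≡⊥ x y = begin
    (x ⊓ y) ⊓ ¬ x    ≡⟨ cong (_⊓ ¬ x) (⊓-comm x y) ⟩
    (y ⊓ x) ⊓ ¬ x    ≡⟨ ⊓-assoc y x (¬ x) ⟩
    y ⊓ (x ⊓ ¬ x)    ≡⟨ cong (y ⊓_) (⊓-¬ x) ⟩
    y ⊓ ⊥            ≡⟨ ⊓-zeroʳ y ⟩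
    ⊥                ∎

  x⊓y⊓z⊓¬x≡⊥ : ∀ x y z → ((x ⊓ y) ⊓ z) ⊓ ¬ x ≡ ⊥
  x⊓y⊓z⊓¬x≡⊥ x y z =
    trans (cong (_⊓ ¬ x) (⊓-assoc x y z)) (x⊓y⊓¬x≡⊥ x (y ⊓ z))

  ¬-split : ∀ x y → ¬ (x ⊓ y) ⊓ ¬ (x ⊓ ¬ y) ≡ ¬ x
  ¬-split x y = begin
    ¬ (x ⊓ y) ⊓ ¬ (x ⊓ ¬ y)    ≡⟨ ¬¬-⊓ (¬ (x ⊓ y)) (¬ (x ⊓ ¬ y)) ⟨
    ¬ ((x ⊓ y) ∨ (x ⊓ ¬ y))    ≡⟨ cong ¬_ (⊓-distrib-∨ x y (¬ y)) ⟨
    ¬ (x ⊓ (y ∨ ¬ y))          ≡⟨ cong (λ t → ¬ (x ⊓ t)) (∨-¬ʳ y) ⟩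
    ¬ (x ⊓ ¬ ⊥)                ≡⟨ cong ¬_ (⊓-¬⊥ʳ x) ⟩
    ¬ ¬ ¬ x                    ≡⟨ ¬¬¬x≡¬x x ⟩
    ¬ x                        ∎

  ¬[¬x⊓y]⊓y≡y⊓x : ∀ x y → ¬ (¬ x ⊓ y) ⊓ y ≡ y ⊓ x
  ¬[¬x⊓y]⊓y≡y⊓x x y = begin
    ¬ (¬ x ⊓ y) ⊓ y      ≡⟨ ⊓-comm (¬ (¬ x ⊓ y)) y ⟩
    y ⊓ ¬ (¬ x ⊓ y)      ≡⟨ cong (λ t → y ⊓ ¬ t) (⊓-¬¬ʳ (¬ x) y) ⟨
    y ⊓ (x ∨ ¬ y)        ≡⟨ ⊓-distrib-∨ y x (¬ y) ⟩
    (y ⊓ x) ∨ (y ⊓ ¬ y)  ≡⟨ cong ((y ⊓ x) ∨_) (⊓-¬ y) ⟩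
    (y ⊓ x) ∨ ⊥          ≡⟨ ∨-⊥ʳ (y ⊓ x) ⟩
    ¬ ¬ (y ⊓ x)          ≡⟨ ¬¬-⊓ y x ⟩
    y ⊓ x                ∎

  x⊓y⊓y≡x⊓y : ∀ x y → (x ⊓ y) ⊓ y ≡ x ⊓ y
  x⊓y⊓y≡x⊓y x y = begin
    (x ⊓ y) ⊓ y    ≡⟨ ⊓-assoc x y y ⟩
    x ⊓ (y ⊓ y)    ≡⟨ cong (x ⊓_) (x⊓x≡¬¬x y) ⟩
    x ⊓ ¬ ¬ y      ≡⟨ ⊓-¬¬ʳ x y ⟩
    x ⊓ y          ∎

  ¬[¬w⊓z]⊓z≡w : ∀ x y z → let w = x ⊓ (y ⊓ z) in ¬ (¬ w ⊓ z) ⊓ z ≡ w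
  ¬[¬w⊓z]⊓z≡w x y z = begin
    ¬ (¬ w ⊓ z) ⊓ z      ≡⟨ ¬[¬x⊓y]⊓y≡y⊓x w z ⟩
    z ⊓ w                ≡⟨ ⊓-comm z w ⟩
    (x ⊓ (y ⊓ z)) ⊓ z    ≡⟨ ⊓-assoc x (y ⊓ z) z ⟩
    x ⊓ ((y ⊓ z) ⊓ z)    ≡⟨ cong (x ⊓_) (x⊓y⊓y≡x⊓y y z) ⟩
    x ⊓ (y ⊓ z)          ∎
    where w = x ⊓ (y ⊓ z)

proposition3p10 : {a : Level} (D : DCoreAlgebra a) → let open DCoreAlgebra D in
    (x y z : Carrier) →
    (((x ⊓ y) ⊓ z) ⊓ (¬ x) ≡ ⊥) × (((x ⊔ y) ⊔ z) ⊔ (⌟ x) ≡ ⊤)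
    × ((¬ (x ⊓ y)) ⊓ (¬ (x ⊓ (¬ y))) ≡ ¬ x) × ((⌟ (x ⊔ y)) ⊔ (⌟ ((⌟ y) ⊔ x)) ≡ ⌟ x)
    × ((¬ ((¬ (x ⊓ (y ⊓ z))) ⊓ z)) ⊓ z ≡ x ⊓ (y ⊓ z))
    × ((⌟ ((⌟ (x ⊔ (y ⊔ z))) ⊔ z)) ⊔ z ≡ x ⊔ (y ⊔ z))
proposition3p10 D x y z =
  P.x⊓y⊓z⊓¬x≡⊥ x y z , Pᵈ.x⊓y⊓z⊓¬x≡⊥ x y z ,
  P.¬-split x y , trans (cong (λ t → ⌟ (x ⊔ y) ⊔ ⌟ t) (⊔-comm (⌟ y) x)) (Pᵈ.¬-split x y) ,
  P.¬[¬w⊓z]⊓z≡w x y z , Pᵈ.¬[¬w⊓z]⊓z≡w x y z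
  where
  open DCoreAlgebra D
  module P = Properties D
  module Pᵈ = Properties (dual D)
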